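{- Let $d \ge 1$. There do not exist an integer $k \ge 2$, pairwise distinct Cartesian subgroups $\Lambda_1, \dots, \Lambda_k$ of $\mathbf{Z}^d$, and vectors $v_1, \dots, v_k \in \mathbf{Z}^d$ such that the cosets $v_1 + \Lambda_1, \dots, v_k + \Lambda_k$ are pairwise disjoint and their union is $\mathbf{Z}^d$.
   Context: A subgroup of $\mathbf{Z}^d$ is called Cartesian if it has the form $\prod_{i=1}^d a_i \mathbf{Z} = a_1\mathbf{Z} \times \cdots \times a_d \mathbf{Z}$ for some positive integers $a_1, \dots, a_d$. -}

module Defs where

open import Data.Nat using (ℕ; _≥_; NonZero)
open import Data.Integer using (ℤ; +_; _-_)
open import Data.Integer.Divisibility using (_∣_)
open import Data.Fin using (Fin)
open import Data.Product using (_×_)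
open import Function.Bundles using (_⇔_)
open import Level using (0ℓ)
open import Relation.Unary using (Pred)

Point : ℕ → Set
Point d = Fin d → ℤ

-- Data of a Cartesian subgroup a₁ℤ × ⋯ × a_dℤ: a vector of positive integers.
record CartesianData (d : ℕ) : Set where
  constructor cart
  field
    mod : Fin d → ℕ
    pos : ∀ i → mod i ≥ 1

open CartesianData public

Subgroup : ∀ {d} → CartesianData d → Pred (Point d) 0ℓ
Subgroup Λ x = ∀ i → (+ mod Λ i) ∣ x i

Coset : ∀ {d} → Point d → CartesianData d → Pred (Point d) 0ℓ
Coset v Λ x = Subgroup Λ (λ i → x i - v i)

SameSubgroup : ∀ {d} → CartesianData d → CartesianData d → Set
SameSubgroup Λ Λ' = ∀ x → (Subgroup Λ x ⇔ Subgroup Λ' x)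

-- Let Λ_j have the largest sum of moduli; as the subgroups are distinct, no other Λᵢ lies in Λ_j.
-- The partition says that w·1[u + Λ] + Σᵢ wᵢ·1[vᵢ + Λᵢ] is constant on u + ρℤ^d, where u = v_j,
-- Λ = Λ_j = bℤ^d, w = wᵢ = 1 and ρ = (1, …, 1); in general we ask that Λ ⊆ ρℤ^d and that every Λᵢ
-- lies in ρℤ^d but not in Λ. While ρ ≠ b, choose a prime p with pρ_c ∣ b_c and let ρ' be ρ with
-- ρ_c replaced by pρ_c. Take τ = ρ_c·M with p ∤ M and every c-th modulus of a Λᵢ ⊄ ρ'ℤ^d dividing τ.
-- Subtracting the identity at x + τe_c from the one at x ∈ u + ρ'ℤ^d cancels those Λᵢ and, as
-- pρ_c ∤ τ, the target term at x + τe_c; every other Λᵢ reappears with centres vᵢ and vᵢ − τe_c,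
-- giving an identity of the same shape at level ρ' with constant 0.
-- Once ρ = b no Λᵢ is left, and evaluating at u gives w = 0, contradicting w = 1.

module Submission where

open import Defs
open import Data.Nat using (ℕ; _≥_)
open import Data.Fin using (Fin)
open import Data.Product using (Σ; _×_; ∃-syntax)
open import Relation.Nullary using (¬_)
open import Relation.Binary.PropositionalEquality using (_≢_)

open import Data.Nat using (zero; suc; _*_; _∸_; _≤_; _<_; _>_; NonZero; NonTrivial)
import Data.Nat.Base as ℕ
import Data.Nat.Properties as ℕₚ
open import Data.Nat.Divisibility
  using (_∣_; _∣?_; divides; ∣-refl; ∣-trans; _∣0; 1∣_; n∣m*n; m∣m*n; *-monoʳ-∣; *-monoˡ-∣; *-cancelʳ-∣; ∣⇒≤; ∣1⇒≡1; 0∣⇒≡0)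
open import Data.Nat.Primality using (Prime; euclidsLemma; prime⇒nonTrivial)
open import Data.Nat.Primality.Factorisation using (factorise)
open import Data.Nat.ListAction using (product)
open import Data.Nat.Induction using (<-wellFounded)
open import Data.Integer as ℤ using (ℤ; +_)
import Data.Integer.Properties as ℤₚ
import Data.Integer.Divisibility as Unsigned
import Data.Integer.Divisibility.Signed as Signed
open import Data.Integer.Tactic.RingSolver using (solve-∀)
open import Data.Nat.Tactic.RingSolver using () renaming (solve-∀ to ℕ-solve-∀)
open import Data.Fin using (zero; suc; _≟_; punchIn)
open import Data.Fin.Properties using (all?; ¬∀⟶∃¬; punchInᵢ≢i)
open import Data.List as List using (List; []; _∷_; filter; allFin)
open import Data.List.Relation.Unary.All as All using (All; []; _∷_)
open import Data.List.Relation.Unary.All.Properties using (all-filter; filter⁺; map⁺; map⁻; tabulate⁺)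
open import Data.List.Membership.Propositional.Properties using (∈-allFin)
open import Data.List.Extrema.Nat using (argmax; f[xs]≤f[argmax])
open import Data.Vec.Functional using (Vector; updateAt; removeAt; toList)
open import Data.Vec.Functional.Properties using (updateAt-updates; updateAt-minimal)
import Algebra.Properties.CommutativeMonoid.Sum as Sum
open import Data.Product using (_,_; proj₁; proj₂)
open import Data.Sum using (inj₁; inj₂)
open import Function using (_∘_; const; _⇔_; mk⇔; Equivalence)
open import Induction.WellFounded using (Acc; acc)
open import Relation.Nullary using (Dec; yes; no; contradiction; ¬?)
open import Relation.Unary using (Decidable)
open import Relation.Binary.PropositionalEquality
  using (_≡_; refl; sym; trans; cong; cong₂; subst; subst₂; module ≡-Reasoning)

module ℕ∑ = Sum ℕₚ.+-0-commutativeMonoid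
module ℤ∑ = Sum ℤₚ.+-0-commutativeMonoid

private variable
  d n : ℕ

sum-mono-≤ : (f g : Vector ℕ n) → (∀ i → f i ≤ g i) → ℕ∑.sum f ≤ ℕ∑.sum g
sum-mono-≤ {zero} f g f≤g = ℕ.z≤n
sum-mono-≤ {suc n} f g f≤g = ℕₚ.+-mono-≤ (f≤g zero) (sum-mono-≤ (f ∘ suc) (g ∘ suc) (f≤g ∘ suc))

sum-mono-< : (f g : Vector ℕ n) → (∀ i → f i ≤ g i) → ∀ c → f c < g c → ℕ∑.sum f < ℕ∑.sum g
sum-mono-< f g f≤g zero lt = ℕₚ.+-mono-<-≤ lt (sum-mono-≤ (f ∘ suc) (g ∘ suc) (f≤g ∘ suc))
sum-mono-< f g f≤g (suc c) lt = ℕₚ.+-mono-≤-< (f≤g zero) (sum-mono-< (f ∘ suc) (g ∘ suc) (f≤g ∘ suc) c lt)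

maximal-index : (f : Vector ℕ (suc n)) → ∃[ j ] ∀ i → f i ≤ f j
maximal-index f = j , λ i → All.lookup (f[xs]≤f[argmax] {f = f} zero (allFin _)) (∈-allFin i)
  where j = argmax f zero (allFin _)

updateAt-pointwise : ∀ {A : Set} (P : Fin n → A → Set) (xs : Vector A n) c (f : A → A) →
                     (∀ i → i ≢ c → P i (xs i)) → P c (f (xs c)) → ∀ i → P i (updateAt xs c f i)
updateAt-pointwise P xs c f elsewhere at-c i with i ≟ c
... | yes refl = subst (P i) (sym (updateAt-updates i xs)) at-c
... | no i≢c = subst (P i) (sym (updateAt-minimal i c xs i≢c)) (elsewhere i i≢c)

prime-divisor : ∀ m .{{_ : NonTrivial m}} → ∃[ p ] Prime p × p ∣ m
prime-divisor m with factorise m {{ℕ.nonTrivial⇒nonZero m}}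
... | record { factors = [] ; isFactorisation = m≡1 } = contradiction m≡1 ℕ.nonTrivial⇒≢1
... | record { factors = p ∷ ps ; isFactorisation = m≡p*∏ps ; factorsPrime = p-prime ∷ _ } =
  p , p-prime , divides (product ps) (trans m≡p*∏ps (ℕₚ.*-comm p (product ps)))

prime-refinement : ∀ {r m} .{{_ : NonZero m}} → r ∣ m → r ≢ m → ∃[ p ] Prime p × p * r ∣ m
prime-refinement {r} (divides 0 refl) _ = contradiction refl (ℕ.≢-nonZero⁻¹ (0 * r))
prime-refinement {r} (divides 1 refl) r≢r = contradiction (sym (ℕₚ.*-identityˡ r)) r≢r
prime-refinement {r} (divides q@(suc (suc _)) refl) _ with prime-divisor q
... | p , p-prime , p∣q = p , p-prime , *-monoˡ-∣ r p∣q

coprime-multiplier : ∀ {p r} → Prime p → (ns : List ℕ) → All (r ∣_) ns →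
                     ∃[ M ] ¬ p ∣ M × All (λ n → ¬ p * r ∣ n → n ∣ r * M) ns
coprime-multiplier {p} p-prime [] [] = 1 , ℕ.nonTrivial⇒≢1 {{prime⇒nonTrivial p-prime}} ∘ ∣1⇒≡1 , []
coprime-multiplier {p} {r} p-prime (n ∷ ns) (r∣n ∷ r∣ns) with coprime-multiplier p-prime ns r∣ns | p * r ∣? n
... | M , p∤M , ns∣rM | yes pr∣n = M , p∤M , contradiction pr∣n ∷ ns∣rM
... | M , p∤M , ns∣rM | no pr∤n with r∣n
...   | divides q refl = q * M , p∤qM , (λ _ → qr∣rqM) ∷ All.map (λ h pr∤n' → ∣-trans (h pr∤n') rM∣rqM) ns∣rM
  where
  p∤qM : ¬ p ∣ q * M
  p∤qM p∣qM with euclidsLemma q M p-prime p∣qM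
  ... | inj₁ p∣q = pr∤n (*-monoˡ-∣ r p∣q)
  ... | inj₂ p∣M = p∤M p∣M
  qr∣rqM : q * r ∣ r * (q * M)
  qr∣rqM = subst (q * r ∣_) (rearrange q r M) (m∣m*n M)
    where
    rearrange : ∀ q r M → q * r * M ≡ r * (q * M)
    rearrange = ℕ-solve-∀
  rM∣rqM : r * M ∣ r * (q * M)
  rM∣rqM = *-monoʳ-∣ r (n∣m*n q)

divisor-nonZero : ∀ {m n} .{{_ : NonZero n}} → m ∣ n → NonZero m
divisor-nonZero {zero} {n} 0∣n = contradiction (0∣⇒≡0 0∣n) (ℕ.≢-nonZero⁻¹ n)
divisor-nonZero {suc m} _ = _

Moduli : ℕ → Set
Moduli d = Vector ℕ d

-- a ∣ᵥ b says that bℤ^d ⊆ aℤ^d, and e ∈Λ a that e lies in a₁ℤ × ⋯ × a_dℤ.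
_∣ᵥ_ : Moduli d → Moduli d → Set
a ∣ᵥ b = ∀ c → a c ∣ b c

_∈Λ_ : Point d → Moduli d → Set
e ∈Λ a = ∀ c → + a c Signed.∣ e c

infixl 6 _+ᵥ_ _-ᵥ_
infix 4 _∣ᵥ_ _∈Λ_ _≋_[mod_] _≋?_[mod_]

_+ᵥ_ _-ᵥ_ : Point d → Point d → Point d
(x +ᵥ y) c = x c ℤ.+ y c
(x -ᵥ y) c = x c ℤ.- y c

_≋_[mod_] : Point d → Point d → Moduli d → Set
x ≋ y [mod a ] = (x -ᵥ y) ∈Λ a

_≋?_[mod_] : (x y : Point d) (a : Moduli d) → Dec (x ≋ y [mod a ])
x ≋? y [mod a ] = all? (λ c → + a c Signed.∣? (x c ℤ.- y c))

coset⇔≋ : ∀ {v x : Point d} {Λ} → Coset v Λ x ⇔ x ≋ v [mod mod Λ ]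
coset⇔≋ = mk⇔ (λ x∈ c → Signed.∣ᵤ⇒∣ (x∈ c)) (λ x≋v c → Signed.∣⇒∣ᵤ (x≋v c))

≋-refl : ∀ {a : Moduli d} x → x ≋ x [mod a ]
≋-refl x c = subst (_ Signed.∣_) (sym (ℤₚ.+-inverseʳ (x c))) (Signed.∣ᵤ⇒∣ (_ ∣0))

≋-weaken : ∀ {a a' : Moduli d} {x y} → a ∣ᵥ a' → x ≋ y [mod a' ] → x ≋ y [mod a ]
≋-weaken a∣a' x≋y c = Signed.∣-trans (Signed.∣ᵤ⇒∣ (a∣a' c)) (x≋y c)

≋-shift : ∀ {a : Moduli d} {e x v} → e ∈Λ a → (x +ᵥ e ≋ v [mod a ] ⇔ x ≋ v [mod a ])
≋-shift {e = e} {x} {v} e∈Λ = mk⇔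
  (λ h c → subst (_ Signed.∣_) (cancel (x c) (e c) (v c)) (Signed.∣m∣n⇒∣m-n (h c) (e∈Λ c)))
  (λ h c → subst (_ Signed.∣_) (reassoc (x c) (e c) (v c)) (Signed.∣m∣n⇒∣m+n (h c) (e∈Λ c)))
  where
  cancel : ∀ x e v → ((x ℤ.+ e) ℤ.- v) ℤ.- e ≡ x ℤ.- v
  cancel = solve-∀
  reassoc : ∀ x e v → (x ℤ.- v) ℤ.+ e ≡ (x ℤ.+ e) ℤ.- v
  reassoc = solve-∀

≋-shift-centre : ∀ {a : Moduli d} {e x v} → (x ≋ v -ᵥ e [mod a ] ⇔ x +ᵥ e ≋ v [mod a ])
≋-shift-centre {e = e} {x} {v} = mk⇔
  (λ h c → subst (_ Signed.∣_) (move (x c) (e c) (v c)) (h c))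
  (λ h c → subst (_ Signed.∣_) (sym (move (x c) (e c) (v c))) (h c))
  where
  move : ∀ x e v → x ℤ.- (v ℤ.- e) ≡ (x ℤ.+ e) ℤ.- v
  move = solve-∀

≋-shift⁻¹ : ∀ {a : Moduli d} {e x v} → x +ᵥ e ≋ v [mod a ] → x ≋ v [mod a ] → e ∈Λ a
≋-shift⁻¹ {e = e} {x} {v} x+e≋v x≋v c =
  subst (_ Signed.∣_) (cancel (x c) (e c) (v c)) (Signed.∣m∣n⇒∣m-n (x+e≋v c) (x≋v c))
  where
  cancel : ∀ x e v → ((x ℤ.+ e) ℤ.- v) ℤ.- (x ℤ.- v) ≡ e
  cancel = solve-∀

𝟙 : ∀ {A : Set} → Dec A → ℤ
𝟙 (yes _) = + 1
𝟙 (no _) = + 0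

𝟙-yes : ∀ {A : Set} → A → (a? : Dec A) → 𝟙 a? ≡ + 1
𝟙-yes a (yes _) = refl
𝟙-yes a (no ¬a) = contradiction a ¬a

𝟙-no : ∀ {A : Set} → ¬ A → (a? : Dec A) → 𝟙 a? ≡ + 0
𝟙-no ¬a (yes a) = contradiction a ¬a
𝟙-no ¬a (no _) = refl

𝟙-cong : ∀ {A B : Set} → A ⇔ B → (a? : Dec A) (b? : Dec B) → 𝟙 a? ≡ 𝟙 b?
𝟙-cong A⇔B (yes a) b? = sym (𝟙-yes (Equivalence.to A⇔B a) b?)
𝟙-cong A⇔B (no ¬a) b? = sym (𝟙-no (¬a ∘ Equivalence.from A⇔B) b?)

indicator : Point d → Moduli d → Point d → ℤ
indicator v a x = 𝟙 (x ≋? v [mod a ])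

indicator-periodic : ∀ {a : Moduli d} {e} v x → e ∈Λ a → indicator v a (x +ᵥ e) ≡ indicator v a x
indicator-periodic v x e∈Λ = 𝟙-cong (≋-shift {x = x} {v} e∈Λ) _ _

indicator-shift-centre : ∀ (a : Moduli d) e v x → indicator (v -ᵥ e) a x ≡ indicator v a (x +ᵥ e)
indicator-shift-centre a e v x = 𝟙-cong (≋-shift-centre {e = e} {x} {v}) _ _

sum-𝟙-unique : ∀ {P : Fin (suc n) → Set} (P? : Decidable P) i₀ → P i₀ → (∀ i → i ≢ i₀ → ¬ P i) →
               ℤ∑.sum (λ i → 𝟙 (P? i)) ≡ + 1
sum-𝟙-unique {n} P? i₀ Pi₀ unique = begin
  ℤ∑.sum (𝟙 ∘ P?)                               ≡⟨ ℤ∑.sum-remove {i = i₀} (𝟙 ∘ P?) ⟩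
  𝟙 (P? i₀) ℤ.+ ℤ∑.sum (removeAt (𝟙 ∘ P?) i₀)  ≡⟨ cong₂ ℤ._+_ (𝟙-yes Pi₀ (P? i₀)) rest-vanishes ⟩
  + 1                                           ∎
  where
  open ≡-Reasoning
  rest-vanishes : ℤ∑.sum (removeAt (𝟙 ∘ P?) i₀) ≡ + 0
  rest-vanishes = trans (ℤ∑.sum-cong-≗ (λ i → 𝟙-no (unique (punchIn i₀ i) (punchInᵢ≢i i₀ i)) (P? (punchIn i₀ i))))
                        (ℤ∑.sum-replicate-zero n)

record WeightedCoset (d : ℕ) : Set where
  constructor weighted
  field
    weight : ℤ
    centre : Point d
    moduli : Moduli d

open WeightedCoset

⟦_⟧ : List (WeightedCoset d) → Point d → ℤ
⟦ [] ⟧ x = + 0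
⟦ weighted w v a ∷ L ⟧ x = w ℤ.* indicator v a x ℤ.+ ⟦ L ⟧ x

⟦⟧-periodic : ∀ {e : Point d} L x → All (λ m → e ∈Λ moduli m) L → ⟦ L ⟧ (x +ᵥ e) ≡ ⟦ L ⟧ x
⟦⟧-periodic [] x [] = refl
⟦⟧-periodic (weighted w v a ∷ L) x (e∈Λa ∷ e∈Λ) =
  cong₂ (λ i s → w ℤ.* i ℤ.+ s) (indicator-periodic v x e∈Λa) (⟦⟧-periodic L x e∈Λ)

⟦⟧-filter : ∀ {P : WeightedCoset d → Set} (P? : Decidable P) L x →
            ⟦ L ⟧ x ≡ ⟦ filter P? L ⟧ x ℤ.+ ⟦ filter (¬? ∘ P?) L ⟧ x
⟦⟧-filter P? [] x = refl
⟦⟧-filter P? (m@(weighted w v a) ∷ L) x with P? m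
... | yes _ = trans (cong (λ s → w ℤ.* indicator v a x ℤ.+ s) (⟦⟧-filter P? L x))
                  (sym (ℤₚ.+-assoc (w ℤ.* indicator v a x) (⟦ filter P? L ⟧ x) (⟦ filter (¬? ∘ P?) L ⟧ x)))
... | no _ = trans (cong (λ s → w ℤ.* indicator v a x ℤ.+ s) (⟦⟧-filter P? L x))
                 (swap (w ℤ.* indicator v a x) (⟦ filter P? L ⟧ x) (⟦ filter (¬? ∘ P?) L ⟧ x))
  where
  swap : ∀ t f g → t ℤ.+ (f ℤ.+ g) ≡ f ℤ.+ (t ℤ.+ g)
  swap = solve-∀

difference : Point d → List (WeightedCoset d) → List (WeightedCoset d)
difference e [] = []
difference e (weighted w v a ∷ L) = weighted w v a ∷ weighted (ℤ.- w) (v -ᵥ e) a ∷ difference e L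

difference-All : ∀ {P : Moduli d → Set} e L → All (P ∘ moduli) L → All (P ∘ moduli) (difference e L)
difference-All e [] [] = []
difference-All e (m ∷ L) (pm ∷ pL) = pm ∷ pm ∷ difference-All e L pL

⟦difference⟧ : ∀ e (L : List (WeightedCoset d)) x → ⟦ difference e L ⟧ x ≡ ⟦ L ⟧ x ℤ.- ⟦ L ⟧ (x +ᵥ e)
⟦difference⟧ e [] x = refl
⟦difference⟧ e (weighted w v a ∷ L) x = begin
  w ℤ.* i ℤ.+ (ℤ.- w ℤ.* indicator (v -ᵥ e) a x ℤ.+ ⟦ difference e L ⟧ x)
    ≡⟨ cong₂ (λ j s → w ℤ.* i ℤ.+ (ℤ.- w ℤ.* j ℤ.+ s)) (indicator-shift-centre a e v x) (⟦difference⟧ e L x) ⟩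
  w ℤ.* i ℤ.+ (ℤ.- w ℤ.* i' ℤ.+ (⟦ L ⟧ x ℤ.- ⟦ L ⟧ (x +ᵥ e)))
    ≡⟨ regroup w i i' (⟦ L ⟧ x) (⟦ L ⟧ (x +ᵥ e)) ⟩
  (w ℤ.* i ℤ.+ ⟦ L ⟧ x) ℤ.- (w ℤ.* i' ℤ.+ ⟦ L ⟧ (x +ᵥ e)) ∎
  where
  open ≡-Reasoning
  i i' : ℤ
  i = indicator v a x
  i' = indicator v a (x +ᵥ e)
  regroup : ∀ w i i' s s' → w ℤ.* i ℤ.+ (ℤ.- w ℤ.* i' ℤ.+ (s ℤ.- s')) ≡ (w ℤ.* i ℤ.+ s) ℤ.- (w ℤ.* i' ℤ.+ s')
  regroup = solve-∀

difference-filter : ∀ {P : WeightedCoset d → Set} (P? : Decidable P) e L x →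
                    All (λ m → ¬ P m → e ∈Λ moduli m) L →
                    ⟦ L ⟧ x ℤ.- ⟦ L ⟧ (x +ᵥ e) ≡ ⟦ difference e (filter P? L) ⟧ x
difference-filter P? e L x periodic = begin
  ⟦ L ⟧ x ℤ.- ⟦ L ⟧ (x +ᵥ e)
    ≡⟨ cong₂ ℤ._-_ (⟦⟧-filter P? L x) (⟦⟧-filter P? L (x +ᵥ e)) ⟩
  (F x ℤ.+ G x) ℤ.- (F (x +ᵥ e) ℤ.+ G (x +ᵥ e))
    ≡⟨ cong (λ g → (F x ℤ.+ G x) ℤ.- (F (x +ᵥ e) ℤ.+ g)) (⟦⟧-periodic rest x rest-periodic) ⟩
  (F x ℤ.+ G x) ℤ.- (F (x +ᵥ e) ℤ.+ G x)
    ≡⟨ cancel (F x) (F (x +ᵥ e)) (G x) ⟩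
  F x ℤ.- F (x +ᵥ e)
    ≡⟨ sym (⟦difference⟧ e (filter P? L) x) ⟩
  ⟦ difference e (filter P? L) ⟧ x ∎
  where
  open ≡-Reasoning
  rest : List (WeightedCoset _)
  rest = filter (¬? ∘ P?) L
  F G : Point _ → ℤ
  F = ⟦ filter P? L ⟧
  G = ⟦ rest ⟧
  rest-periodic : All (λ m → e ∈Λ moduli m) rest
  rest-periodic = All.zipWith (λ (h , ¬p) → h ¬p) (filter⁺ (¬? ∘ P?) periodic , all-filter (¬? ∘ P?) L)
  cancel : ∀ f f' g → (f ℤ.+ g) ℤ.- (f' ℤ.+ g) ≡ f ℤ.- f'
  cancel = solve-∀

⟦toList⟧ : ∀ (ms : Vector (WeightedCoset d) n) x →
           ⟦ toList ms ⟧ x ≡ ℤ∑.sum (λ i → weight (ms i) ℤ.* indicator (centre (ms i)) (moduli (ms i)) x)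
⟦toList⟧ {n = zero} ms x = refl
⟦toList⟧ {n = suc n} ms x =
  cong (λ s → weight (ms zero) ℤ.* indicator (centre (ms zero)) (moduli (ms zero)) x ℤ.+ s) (⟦toList⟧ (ms ∘ suc) x)

refined : Moduli d → Fin d → ℕ → Moduli d
refined ρ c p = updateAt ρ c (p *_)

refined-c : ∀ (ρ : Moduli d) c p → refined ρ c p c ≡ p * ρ c
refined-c ρ c p = updateAt-updates c ρ

∣ᵥ-refined : ∀ (ρ : Moduli d) c p → ρ ∣ᵥ refined ρ c p
∣ᵥ-refined ρ c p = updateAt-pointwise (λ i z → ρ i ∣ z) ρ c (p *_) (λ _ _ → ∣-refl) (n∣m*n p)

refined-∣ᵥ : ∀ {ρ a : Moduli d} {c p} → p * ρ c ∣ a c → ρ ∣ᵥ a → refined ρ c p ∣ᵥ a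
refined-∣ᵥ {ρ = ρ} {a} {c} {p} pρc∣ac ρ∣a = updateAt-pointwise (λ i z → z ∣ a i) ρ c (p *_) (λ i _ → ρ∣a i) pρc∣ac

axis-shift : Fin d → ℕ → Point d
axis-shift c τ = updateAt (const (+ 0)) c (const (+ τ))

axis-shift-∈Λ : ∀ {a : Moduli d} {c τ} → a c ∣ τ → axis-shift c τ ∈Λ a
axis-shift-∈Λ {a = a} {c} {τ} ac∣τ =
  updateAt-pointwise (λ i z → + a i Signed.∣ z) (const (+ 0)) c (const (+ τ))
    (λ i _ → Signed.∣ᵤ⇒∣ (a i ∣0)) (Signed.∣ᵤ⇒∣ ac∣τ)

axis-shift-∈Λ⁻¹ : ∀ {a : Moduli d} {c τ} → axis-shift c τ ∈Λ a → a c ∣ τ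
axis-shift-∈Λ⁻¹ {a = a} {c} {τ} e∈Λ = Signed.∣⇒∣ᵤ (subst (+ a c Signed.∣_) (updateAt-updates c (const (+ 0))) (e∈Λ c))

module Refinement {d} (u : Point d) (b : Moduli d) (b>0 : ∀ c → b c > 0) where

  Admissible : Moduli d → Moduli d → Set
  Admissible ρ a = ρ ∣ᵥ a × ¬ b ∣ᵥ a

  ConstantOn : Moduli d → ℤ → List (WeightedCoset d) → ℤ → Set
  ConstantOn ρ w L K = ∀ x → x ≋ u [mod ρ ] → w ℤ.* indicator u b x ℤ.+ ⟦ L ⟧ x ≡ K

  gap : Moduli d → ℕ
  gap ρ = ℕ∑.sum (λ c → b c ∸ ρ c)

  instance
    b-nonZero : ∀ {c} → NonZero (b c)
    b-nonZero {c} = ℕ.>-nonZero (b>0 c)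

  weight-at-finest : ∀ {ρ w L K} → (∀ c → ρ c ≡ b c) → All (Admissible ρ ∘ moduli) L → ConstantOn ρ w L K → w ≡ K
  weight-at-finest {w = w} {K = K} _ [] const = begin
    w                                  ≡⟨ sym (ℤₚ.*-identityʳ w) ⟩
    w ℤ.* + 1                          ≡⟨ cong (w ℤ.*_) (sym (𝟙-yes (≋-refl u) _)) ⟩
    w ℤ.* indicator u b u              ≡⟨ sym (ℤₚ.+-identityʳ _) ⟩
    w ℤ.* indicator u b u ℤ.+ ⟦ [] ⟧ u ≡⟨ const u (≋-refl u) ⟩
    K                                  ∎
    where open ≡-Reasoning
  weight-at-finest ρ≡b ((ρ∣a , b∤a) ∷ _) _ = contradiction (λ c → subst (_∣ _) (ρ≡b c) (ρ∣a c)) b∤a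

  gap-refined : ∀ {ρ c p} → Prime p → ρ ∣ᵥ b → p * ρ c ∣ b c → gap (refined ρ c p) < gap ρ
  gap-refined {ρ} {c} {p} p-prime ρ∣b pρc∣bc =
    sum-mono-< _ _ (λ i → ℕₚ.∸-monoʳ-≤ (b i) (ρ≤ρ' i)) c (ℕₚ.∸-monoʳ-< ρc<ρ'c (∣⇒≤ (ρ'∣b c)))
    where
    ρ' : Moduli d
    ρ' = refined ρ c p
    ρ'∣b : ρ' ∣ᵥ b
    ρ'∣b = refined-∣ᵥ {p = p} pρc∣bc ρ∣b
    ρ≤ρ' : ∀ i → ρ i ≤ ρ' i
    ρ≤ρ' i = ∣⇒≤ {{divisor-nonZero (ρ'∣b i)}} (∣ᵥ-refined ρ c p i)
    ρc<ρ'c : ρ c < ρ' c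
    ρc<ρ'c = subst (ρ c <_) (trans (ℕₚ.*-comm (ρ c) p) (sym (refined-c ρ c p)))
               (ℕₚ.m<m*n (ρ c) p {{divisor-nonZero (ρ∣b c)}} (ℕ.nonTrivial⇒n>1 p {{prime⇒nonTrivial p-prime}}))

  refine : ∀ {ρ c p w L K} → Prime p → ρ ∣ᵥ b → p * ρ c ∣ b c →
           All (Admissible ρ ∘ moduli) L → ConstantOn ρ w L K →
           ∃[ L' ] All (Admissible (refined ρ c p) ∘ moduli) L' × ConstantOn (refined ρ c p) w L' (+ 0)
  refine {ρ} {c} {p} {w} {L} {K} p-prime ρ∣b pρc∣bc admissible constant =
    difference e (filter P? L) , admissible' , constant'
    where
    ρ' : Moduli d
    ρ' = refined ρ c p

    P : WeightedCoset d → Set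
    P m = p * ρ c ∣ moduli m c
    P? : Decidable P
    P? m = p * ρ c ∣? moduli m c

    multiplier : ∃[ M ] ¬ p ∣ M × All (λ n → ¬ p * ρ c ∣ n → n ∣ ρ c * M) (List.map (λ m → moduli m c) L)
    multiplier = coprime-multiplier p-prime (List.map (λ m → moduli m c) L)
                   (map⁺ (All.map (λ (ρ∣a , _) → ρ∣a c) admissible))
    M : ℕ
    M = proj₁ multiplier
    e : Point d
    e = axis-shift c (ρ c * M)

    periodic : All (λ m → ¬ P m → e ∈Λ moduli m) L
    periodic = All.map (λ ac∣ρcM ¬Pm → axis-shift-∈Λ (ac∣ρcM ¬Pm)) (map⁻ (proj₂ (proj₂ multiplier)))

    admissible' : All (Admissible ρ' ∘ moduli) (difference e (filter P? L))
    admissible' = difference-All e _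
      (All.zipWith (λ (Pm , ρ∣a , b∤a) → refined-∣ᵥ {p = p} Pm ρ∣a , b∤a) (all-filter P? L , filter⁺ P? admissible))

    target-missed : ∀ x → x ≋ u [mod ρ' ] → indicator u b (x +ᵥ e) ≡ + 0
    target-missed x x≋u = 𝟙-no (λ x+e≋u → proj₁ (proj₂ multiplier) (p∣M x+e≋u)) _
      where
      p∣M : x +ᵥ e ≋ u [mod b ] → p ∣ M
      p∣M x+e≋u = *-cancelʳ-∣ (ρ c) {{divisor-nonZero (ρ∣b c)}}
        (subst₂ _∣_ (refined-c ρ c p) (ℕₚ.*-comm (ρ c) M)
          (axis-shift-∈Λ⁻¹ {a = ρ'} (≋-shift⁻¹ {e = e} {x} {u}
            (≋-weaken {x = x +ᵥ e} {u} (refined-∣ᵥ {p = p} pρc∣bc ρ∣b) x+e≋u) x≋u)))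

    constant' : ConstantOn ρ' w (difference e (filter P? L)) (+ 0)
    constant' x x≋u = begin
      w ℤ.* indicator u b x ℤ.+ ⟦ difference e (filter P? L) ⟧ x
        ≡⟨ cong (λ s → w ℤ.* indicator u b x ℤ.+ s) (sym (difference-filter P? e L x periodic)) ⟩
      w ℤ.* indicator u b x ℤ.+ (⟦ L ⟧ x ℤ.- ⟦ L ⟧ (x +ᵥ e))
        ≡⟨ regroup w (indicator u b x) (⟦ L ⟧ x) (⟦ L ⟧ (x +ᵥ e)) ⟩
      (w ℤ.* indicator u b x ℤ.+ ⟦ L ⟧ x) ℤ.- (w ℤ.* + 0 ℤ.+ ⟦ L ⟧ (x +ᵥ e))
        ≡⟨ cong (λ i → (w ℤ.* indicator u b x ℤ.+ ⟦ L ⟧ x) ℤ.- (w ℤ.* i ℤ.+ ⟦ L ⟧ (x +ᵥ e))) (sym (target-missed x x≋u)) ⟩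
      (w ℤ.* indicator u b x ℤ.+ ⟦ L ⟧ x) ℤ.- (w ℤ.* indicator u b (x +ᵥ e) ℤ.+ ⟦ L ⟧ (x +ᵥ e))
        ≡⟨ cong₂ ℤ._-_ (constant x x≋ρu) (constant (x +ᵥ e) x+e≋ρu) ⟩
      K ℤ.- K
        ≡⟨ ℤₚ.+-inverseʳ K ⟩
      + 0 ∎
      where
      open ≡-Reasoning
      x≋ρu : x ≋ u [mod ρ ]
      x≋ρu = ≋-weaken {x = x} {u} (∣ᵥ-refined ρ c p) x≋u
      x+e≋ρu : x +ᵥ e ≋ u [mod ρ ]
      x+e≋ρu = Equivalence.from (≋-shift {e = e} {x} {u} (axis-shift-∈Λ (m∣m*n M))) x≋ρu
      regroup : ∀ w i s s' → w ℤ.* i ℤ.+ (s ℤ.- s') ≡ (w ℤ.* i ℤ.+ s) ℤ.- (w ℤ.* + 0 ℤ.+ s')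
      regroup = solve-∀

  weight-vanishes : ∀ {ρ w L K} → Acc _<_ (gap ρ) → ρ ∣ᵥ b → ¬ (∀ c → ρ c ≡ b c) →
                    All (Admissible ρ ∘ moduli) L → ConstantOn ρ w L K → w ≡ + 0
  weight-vanishes {ρ} {w} {L} {K} (acc descend) ρ∣b ρ≢b admissible constant
    with ¬∀⟶∃¬ _ _ (λ c → ρ c ℕₚ.≟ b c) ρ≢b
  ... | c , ρc≢bc with prime-refinement (ρ∣b c) ρc≢bc
  ... | p , p-prime , pρc∣bc with refine {ρ} {c} {p} {w} {L} {K} p-prime ρ∣b pρc∣bc admissible constant
  ... | L' , admissible' , constant' with all? (λ i → refined ρ c p i ℕₚ.≟ b i)
  ...   | yes ρ'≡b = weight-at-finest {L = L'} ρ'≡b admissible' constant'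
  ...   | no ρ'≢b = weight-vanishes (descend (gap-refined p-prime ρ∣b pρc∣bc))
                      (refined-∣ᵥ {p = p} pρc∣bc ρ∣b) ρ'≢b admissible' constant'

∣ᵥ∧sum≤⇒≡ : ∀ {a b : Moduli d} → (∀ c → a c > 0) → b ∣ᵥ a → ℕ∑.sum a ≤ ℕ∑.sum b → ∀ c → b c ≡ a c
∣ᵥ∧sum≤⇒≡ {a = a} {b} a>0 b∣a Σa≤Σb c with b c ℕₚ.≟ a c
... | yes bc≡ac = bc≡ac
... | no bc≢ac = contradiction Σa≤Σb (ℕₚ.<⇒≱ (sum-mono-< b a b≤a c (ℕₚ.≤∧≢⇒< (b≤a c) bc≢ac)))
  where
  b≤a : ∀ i → b i ≤ a i
  b≤a i = ∣⇒≤ {{ℕ.>-nonZero (a>0 i)}} (b∣a i)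

same-subgroup : ∀ {Λ Λ' : CartesianData d} → (∀ c → mod Λ c ≡ mod Λ' c) → SameSubgroup Λ Λ'
same-subgroup Λ≡Λ' x = mk⇔ (λ x∈Λ c → subst (λ m → + m Unsigned.∣ x c) (Λ≡Λ' c) (x∈Λ c))
                           (λ x∈Λ' c → subst (λ m → + m Unsigned.∣ x c) (sym (Λ≡Λ' c)) (x∈Λ' c))

exact-cover-sum : ∀ {Λ : Fin (suc n) → CartesianData d} {v : Fin (suc n) → Point d} →
                  (∀ i j → i ≢ j → ∀ x → Coset (v i) (Λ i) x → ¬ Coset (v j) (Λ j) x) →
                  (∀ x → ∃[ i ] Coset (v i) (Λ i) x) →
                  ∀ x → ℤ∑.sum (λ i → indicator (v i) (mod (Λ i)) x) ≡ + 1
exact-cover-sum {n = n} {Λ = Λ} {v} disjoint cover x =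
  sum-𝟙-unique (λ i → x ≋? v i [mod mod (Λ i) ]) i₀ (Equivalence.to (coset⇔≋ {v = v i₀} {x} {Λ i₀}) x∈i₀)
    (λ i i≢i₀ x∈i → disjoint i₀ i (i≢i₀ ∘ sym) x x∈i₀ (Equivalence.from (coset⇔≋ {v = v i} {x} {Λ i}) x∈i))
  where
  i₀ : Fin (suc n)
  i₀ = proj₁ (cover x)
  x∈i₀ : Coset (v i₀) (Λ i₀) x
  x∈i₀ = proj₂ (cover x)

largest-not-contained : ∀ {k} {Λ : Fin k → CartesianData d} →
                        (∀ i j → i ≢ j → ¬ SameSubgroup (Λ i) (Λ j)) →
                        ∀ {j} → (∀ i → ℕ∑.sum (mod (Λ i)) ≤ ℕ∑.sum (mod (Λ j))) →
                        ∀ i → i ≢ j → ¬ mod (Λ j) ∣ᵥ mod (Λ i)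
largest-not-contained {Λ = Λ} distinct {j} largest i i≢j Λi⊆Λj =
  distinct i j i≢j (same-subgroup {Λ = Λ i} {Λ j} (sym ∘ ∣ᵥ∧sum≤⇒≡ (pos (Λ i)) Λi⊆Λj (largest i)))

disjoint⇒proper : ∀ {k} {Λ : Fin k → CartesianData d} {v : Fin k → Point d} →
                  (∀ i j → i ≢ j → ∀ x → Coset (v i) (Λ i) x → ¬ Coset (v j) (Λ j) x) →
                  ∀ {i j} → i ≢ j → ¬ (∀ c → 1 ≡ mod (Λ j) c)
disjoint⇒proper {Λ = Λ} {v} disjoint {i} {j} i≢j Λj≡ℤ^d =
  disjoint i j i≢j (v i) (Equivalence.from (coset⇔≋ {v = v i} {v i} {Λ i}) (≋-refl (v i)))
    (λ c → subst (λ m → + m Unsigned.∣ v i c ℤ.- v j c) (Λj≡ℤ^d c) (1∣ _))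

mainTheorem1 : (d : ℕ) → d ≥ 1 →
    ¬ (Σ ℕ λ k → Σ (Fin k → CartesianData d) λ Λ → Σ (Fin k → Point d) λ v →
        (k ≥ 2
        × (∀ (i j : Fin k) → i ≢ j → ¬ SameSubgroup (Λ i) (Λ j))
        × (∀ (i j : Fin k) → i ≢ j → ∀ x → Coset (v i) (Λ i) x → ¬ Coset (v j) (Λ j) x)
        × (∀ (x : Point d) → ∃[ i ] Coset (v i) (Λ i) x)))
mainTheorem1 d _ (suc (suc n) , Λ , v , _ , distinct , disjoint , cover) =
  contradiction (weight-vanishes {const 1} {+ 1} {others} {+ 1} (<-wellFounded _) (λ _ → 1∣ _)
                   (disjoint⇒proper {Λ = Λ} disjoint (punchInᵢ≢i j zero)) admissible constant) λ ()
  where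
  largest : ∃[ j ] ∀ i → ℕ∑.sum (mod (Λ i)) ≤ ℕ∑.sum (mod (Λ j))
  largest = maximal-index (ℕ∑.sum ∘ mod ∘ Λ)
  j : Fin (suc (suc n))
  j = proj₁ largest
  open Refinement (v j) (mod (Λ j)) (pos (Λ j))

  cosets : Vector (WeightedCoset d) (suc (suc n))
  cosets i = weighted (+ 1) (v i) (mod (Λ i))

  others : List (WeightedCoset d)
  others = toList (removeAt cosets j)

  admissible : All (Admissible (const 1) ∘ moduli) others
  admissible = tabulate⁺ {f = removeAt cosets j}
    (λ i → (λ _ → 1∣ _) , largest-not-contained {Λ = Λ} distinct (proj₂ largest) (punchIn j i) (punchInᵢ≢i j i))

  constant : ConstantOn (const 1) (+ 1) others (+ 1)
  constant x _ = begin
    f j ℤ.+ ⟦ others ⟧ x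
      ≡⟨ cong (λ s → f j ℤ.+ s) (⟦toList⟧ (removeAt cosets j) x) ⟩
    f j ℤ.+ ℤ∑.sum (removeAt f j)
      ≡⟨ ℤ∑.sum-remove f ⟨
    ℤ∑.sum f
      ≡⟨ ℤ∑.sum-cong-≗ (λ i → ℤₚ.*-identityˡ (indicator (v i) (mod (Λ i)) x)) ⟩
    ℤ∑.sum (λ i → indicator (v i) (mod (Λ i)) x)
      ≡⟨ exact-cover-sum {Λ = Λ} {v} disjoint cover x ⟩
    + 1 ∎
    where
    open ≡-Reasoning
    f : Vector ℤ (suc (suc n))
    f i = + 1 ℤ.* indicator (v i) (mod (Λ i)) x
mainTheorem1 d _ (zero , _ , _ , () , _)
mainTheorem1 d _ (suc zero , _ , _ , ℕ.s≤s () , _)
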